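{- Let $p,p'\in\mathbb N$ and let $Q,Q'$ be $\lambda$-terms. If $\lambda y.Q\in\mathrm{ETA}_p$ and $BT(Q)\le^\eta_{p'}BT(Q')$, then $\lambda y.Q'\in\mathrm{ETA}_{p+p'}$.
   Context: $BT(\cdot)$ denotes Böhm trees. $\mathrm{ETA}$ is the set of terms $Q$ with $Q\twoheadrightarrow_{\beta\eta}\lambda x.x$. Size: $|Q|=0$ if $Q\twoheadrightarrow_\beta\lambda x.x$, and $|Q|=\max\{m,\max_{i\le m}|\lambda z_i.Q_i|+1\}$ if $Q\twoheadrightarrow_\beta\lambda yz_1\dots z_m.yQ_1\cdots Q_m$, $m\ge1$. $\mathrm{ETA}_p=\{Q\in\mathrm{ETA}:|Q|<p\}$. $\le^\eta_p$ is the greatest relation on Böhm-like trees such that $U\le^\eta_pV$ implies $U=V=\bot$, or $U=\lambda\vec x.yU_1\cdots U_k$, $V=\lambda\vec xz_1\dots z_m.yV_1\cdots V_kQ_1\cdots Q_m$ with $m\le p$, $\vec z$ not free in $yU_1\cdots U_kV_1\cdots V_k$, $U_j\le^\eta_pV_j$, and $\lambda z_i.Q_i\in\mathrm{ETA}_p$. -}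

module Defs where

open import Data.Nat using (ℕ; zero; suc; _+_; _∸_; _≤_; _<_; _⊔_; _≟_)
open import Data.Fin using (Fin; toℕ)
open import Data.List using (List; []; _∷_; length; lookup; _++_; foldl)
open import Data.Maybe using (Maybe; just; nothing)
open import Data.Sum using (_⊎_)
open import Level using () renaming (suc to lsuc; zero to lzero)
open import Data.Product using (Σ; ∃; _×_; _,_)
open import Data.Bool using (if_then_else_)
open import Relation.Nullary using (¬_; does)
open import Relation.Binary.PropositionalEquality using (_≡_)
open import Relation.Binary.Construct.Closure.ReflexiveTransitive using (Star)

-- Untyped λ-terms, de Bruijn indices (index 0 = innermost binder)

data Term : Set where
  var : ℕ → Term
  app : Term → Term → Term
  lam : Term → Term

ext : (ℕ → ℕ) → ℕ → ℕ
ext ρ zero    = zero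
ext ρ (suc j) = suc (ρ j)

rename : (ℕ → ℕ) → Term → Term
rename ρ (var j)   = var (ρ j)
rename ρ (app M N) = app (rename ρ M) (rename ρ N)
rename ρ (lam M)   = lam (rename (ext ρ) M)

exts : (ℕ → Term) → ℕ → Term
exts σ zero    = var zero
exts σ (suc j) = rename suc (σ j)

subst : (ℕ → Term) → Term → Term
subst σ (var j)   = σ j
subst σ (app M N) = app (subst σ M) (subst σ N)
subst σ (lam M)   = lam (subst (exts σ) M)

single : Term → ℕ → Term
single N zero    = N
single N (suc j) = var j

data _→β_ : Term → Term → Set where
  β     : ∀ {M N} → app (lam M) N →β subst (single N) M
  appL  : ∀ {M M' N} → M →β M' → app M N →β app M' N
  appR  : ∀ {M N N'} → N →β N' → app M N →β app M N'
  lamξ  : ∀ {M M'} → M →β M' → lam M →β lam M'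

-- one-step βη-reduction (compatible closure);
-- η : λx. N x → N  with x not free in N, i.e. the body is (N shifted) applied to var 0
data _→βη_ : Term → Term → Set where
  β     : ∀ {M N} → app (lam M) N →βη subst (single N) M
  η     : ∀ {N} → lam (app (rename suc N) (var zero)) →βη N
  appL  : ∀ {M M' N} → M →βη M' → app M N →βη app M' N
  appR  : ∀ {M N N'} → N →βη N' → app M N →βη app M N'
  lamξ  : ∀ {M M'} → M →βη M' → lam M →βη lam M'

_↠β_ : Term → Term → Set
_↠β_ = Star _→β_

_↠βη_ : Term → Term → Set
_↠βη_ = Star _→βη_

lams : ℕ → Term → Term
lams zero    M = M
lams (suc n) M = lam (lams n M)

apps : ℕ → List Term → Term
apps h Ms = foldl app (var h) Ms

idT : Term
idT = lam (var zero)

-- renaming sending variable k to 0 and every other j to j+1; used to form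
-- λzᵢ.Qᵢ when zᵢ has index k in the context of Qᵢ
pull : ℕ → ℕ → ℕ
pull k j = if does (j ≟ k) then zero else suc j

-- λzᵢ.Qᵢ for the entry at (0-based) position j of a list of length m whose
-- entries live under the binders y z₁ … zₘ (zₘ has index 0, so z_{j+1} has index m ∸ (j+1))
lamZ : ∀ (Qs : List Term) → Fin (length Qs) → Term
lamZ Qs j = lam (rename (pull (length Qs ∸ suc (toℕ j))) (lookup Qs j))

maxF : ∀ m → (Fin m → ℕ) → ℕ
maxF zero    f = zero
maxF (suc m) f = f Fin.zero ⊔ maxF m (λ i → f (Fin.suc i))
  where import Data.Fin as Fin

-- Size |Q| (as a relation; it is a function on ETA)
data Size : Term → ℕ → Set where
  size-id : ∀ {Q} → Q ↠β idT → Size Q zero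
  size-hnf : ∀ {Q} (Qs : List Term) (s : Fin (length Qs) → ℕ) →
             1 ≤ length Qs →
             Q ↠β lams (suc (length Qs)) (apps (length Qs) Qs) →
             (∀ j → Size (lamZ Qs j) (s j)) →
             Size Q (length Qs ⊔ suc (maxF (length Qs) s))

ETA : Term → Set
ETA Q = Q ↠βη idT

ETAp : ℕ → Term → Set
ETAp p Q = ETA Q × Σ ℕ (λ s → Size Q s × s < p)

-- Böhm-like trees, represented without coinduction as labelling functions on
-- positions (paths of child indices).  A node label  lbl n h k  stands for
-- λx₁…xₙ. y T₁ ⋯ Tₖ  where h is the de Bruijn index of the head variable y
-- (relative to the context after the n binders).  'nothing' is ⊥.
-- Only positions reachable from the root through defined nodes and child
-- indices < k are meaningful; every notion below only inspects those.

record Label : Set where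
  constructor lbl
  field
    binders : ℕ
    head    : ℕ
    arity   : ℕ

Tree : Set
Tree = List ℕ → Maybe Label

sub : Tree → ℕ → Tree
sub T i π = T (i ∷ π)

rootBinders : Tree → ℕ
rootBinders T with T []
... | nothing = zero
... | just (lbl n _ _) = n

-- number of λ-binders strictly above position π (on the path from the root)
bAbove : Tree → List ℕ → ℕ
bAbove T []      = zero
bAbove T (i ∷ π) = rootBinders T + bAbove (sub T i) π

extN : ℕ → (ℕ → ℕ) → ℕ → ℕ
extN zero    ρ = ρ
extN (suc n) ρ = ext (extN n ρ)

renT : (ℕ → ℕ) → Tree → Tree
renT ρ T π with T π
... | nothing = nothing
... | just (lbl n h k) = just (lbl n (extN (bAbove T π + n) ρ h) k)

lamT : Tree → Tree
lamT T [] with T []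
... | nothing = nothing
... | just (lbl n h k) = just (lbl (suc n) h k)
lamT T (i ∷ π) = T (i ∷ π)

-- the free variable x (index relative to the root context of T) occurs in T
data FreeIn : ℕ → Tree → Set where
  here  : ∀ {x T n h k} → T [] ≡ just (lbl n h k) → h ≡ n + x → FreeIn x T
  there : ∀ {x T n h k} (i : ℕ) → T [] ≡ just (lbl n h k) → i < k →
          FreeIn (n + x) (sub T i) → FreeIn x T

-- T is the Böhm tree of M: the greatest relation closed under the clauses

BTStep : (Term → Tree → Set) → Term → Tree → Set
BTStep R M T =
  (¬ HasHNF M × T [] ≡ nothing) ⊎
  (Σ ℕ λ n → Σ ℕ λ h → Σ (List Term) λ Ms →
     M ↠β lams n (apps h Ms) × T [] ≡ just (lbl n h (length Ms)) ×
     (∀ (j : Fin (length Ms)) → R (lookup Ms j) (sub T (toℕ j))))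
  where
  HasHNF : Term → Set
  HasHNF M = Σ ℕ λ n → Σ ℕ λ h → Σ (List Term) λ Ms → M ↠β lams n (apps h Ms)

IsBT : Term → Tree → Set₁
IsBT M T = Σ (Term → Tree → Set) λ R → R M T × (∀ M' T' → R M' T' → BTStep R M' T')

-- for a Böhm-like tree T:  T ∈ ETA_p  means T is the Böhm tree of a term in ETA_p
TETAp : ℕ → Tree → Set₁
TETAp p T = Σ Term λ M → ETAp p M × IsBT M T

-- U ≤^η_p V : the greatest relation R such that R U V implies
--   U = V = ⊥, or
--   U = λx⃗. y U₁ ⋯ Uₖ ,  V = λx⃗ z₁…zₘ. y V₁ ⋯ Vₖ Q₁ ⋯ Qₘ  with  m ≤ p,
--   z⃗ not free in Vⱼ and R Uⱼ Vⱼ (Vⱼ read in the context without z⃗, i.e.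
--   strengthened by m), and λzᵢ.Qᵢ ∈ ETA_p.
-- In V the head y has index h + m since z⃗ are the innermost binders.
-- Qᵢ is child k+(i-1) of V and zᵢ has index m ∸ i in its root context.

LeStep : ℕ → (Tree → Tree → Set) → Tree → Tree → Set₁
LeStep p R U V =
  (U [] ≡ nothing × V [] ≡ nothing) ⊎
  (Σ ℕ λ n → Σ ℕ λ h → Σ ℕ λ k → Σ ℕ λ m →
     U [] ≡ just (lbl n h k) ×
     V [] ≡ just (lbl (n + m) (h + m) (k + m)) ×
     m ≤ p ×
     (∀ j → j < k →
        (∀ x → x < m → ¬ FreeIn x (sub V j)) ×
        R (sub U j) (renT (λ x → x ∸ m) (sub V j))) ×
     (∀ i → i < m →
        TETAp p (lamT (renT (pull (m ∸ suc i)) (sub V (k + i))))))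

_≤η[_]_ : Tree → ℕ → Tree → Set₁
U ≤η[ p ] V = Σ (Tree → Tree → Set) λ R → R U V × (∀ U' V' → R U' V' → LeStep p R U' V')

module Submission where

-- The proof goes through Böhm trees.  Call T an η-expansion tree of the
-- variable x of size at most s (EtaTree s x T) when T = λz₁…zₘ. x T₁ ⋯ Tₘ
-- with m ≤ s and every Tⱼ an η-expansion tree of zⱼ of size below s.
-- The theorem follows from three facts:
--  (1) terms to trees: if λy.Q has size s then BT(Q) is an η-expansion tree
--      of y of size at most s (etaTree-of-size, etaTree-of-lam);
--  (2) trees: U ≤^η_{p'} V turns an η-expansion tree U of size at most s into
--      one of size at most s + p', since every node of V carries at most p'
--      extra arguments λzᵢ.Qᵢ ∈ ETA_{p'} (etaTree-≤η);
--  (3) trees to terms: a term whose Böhm tree is an η-expansion tree of x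
--      βη-reduces to x (etaTree⇒↠βη) and, once x is abstracted, has size
--      at most s (etaTree⇒size).

open import Defs
open import Data.Nat
  using (ℕ; zero; suc; _+_; _∸_; _≤_; _<_; _⊔_; _≡ᵇ_; _≤?_; _<?_; z≤n; s≤s; s≤s⁻¹; z<s)
open import Data.Bool using (true; false)
open import Data.Unit using (tt)
open import Data.Nat.Properties
import Data.Fin as Fin
open import Data.Fin using (Fin; toℕ; fromℕ<)
open import Data.Fin.Properties using (toℕ-fromℕ<; toℕ<n)
open import Data.List using (List; []; _∷_; length; foldl; map; _++_; lookup)
open import Data.List.Properties using (length-map; foldl-++; ++-identityʳ; ++-assoc)
open import Data.List.Relation.Binary.Pointwise using (Pointwise; []; _∷_; Pointwise-length)
open import Data.Maybe using (Maybe; just; nothing)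
open import Data.Product using (Σ; _×_; _,_; proj₁; proj₂)
open import Data.Sum using (_⊎_; inj₁; inj₂)
open import Data.Empty using (⊥-elim)
open import Function using (_∘_; id)
open import Relation.Nullary using (¬_; yes; no)
open import Relation.Binary.PropositionalEquality
  using (_≡_; _≢_; refl; sym; trans; cong; cong₂; _≗_; module ≡-Reasoning)
  renaming (subst to transport; subst₂ to transport₂)
open import Relation.Binary.Construct.Closure.ReflexiveTransitive
  using (Star; ε; _◅_; _◅◅_; gmap)

-- Substitution algebra

ext-cong : ∀ {ρ ρ'} → ρ ≗ ρ' → ext ρ ≗ ext ρ'
ext-cong e zero    = refl
ext-cong e (suc j) = cong suc (e j)

rename-cong : ∀ {ρ ρ'} → ρ ≗ ρ' → ∀ M → rename ρ M ≡ rename ρ' M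
rename-cong e (var j)   = cong var (e j)
rename-cong e (app M N) = cong₂ app (rename-cong e M) (rename-cong e N)
rename-cong e (lam M)   = cong lam (rename-cong (ext-cong e) M)

exts-cong : ∀ {σ σ'} → σ ≗ σ' → exts σ ≗ exts σ'
exts-cong e zero    = refl
exts-cong e (suc j) = cong (rename suc) (e j)

subst-cong : ∀ {σ σ'} → σ ≗ σ' → ∀ M → subst σ M ≡ subst σ' M
subst-cong e (var j)   = e j
subst-cong e (app M N) = cong₂ app (subst-cong e M) (subst-cong e N)
subst-cong e (lam M)   = cong lam (subst-cong (exts-cong e) M)

rename-rename : ∀ ρ ρ' M → rename ρ (rename ρ' M) ≡ rename (ρ ∘ ρ') M
rename-rename ρ ρ' (var j)   = refl
rename-rename ρ ρ' (app M N) = cong₂ app (rename-rename ρ ρ' M) (rename-rename ρ ρ' N)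
rename-rename ρ ρ' (lam M)   = cong lam (trans (rename-rename (ext ρ) (ext ρ') M)
  (rename-cong (λ { zero → refl ; (suc j) → refl }) M))

rename-subst : ∀ ρ σ M → rename ρ (subst σ M) ≡ subst (rename ρ ∘ σ) M
rename-subst ρ σ (var j)   = refl
rename-subst ρ σ (app M N) = cong₂ app (rename-subst ρ σ M) (rename-subst ρ σ N)
rename-subst ρ σ (lam M)   = cong lam (trans (rename-subst (ext ρ) (exts σ) M)
  (subst-cong (λ { zero → refl ; (suc j) → trans (rename-rename (ext ρ) suc (σ j))
                                              (sym (rename-rename suc ρ (σ j))) }) M))

subst-rename : ∀ σ ρ M → subst σ (rename ρ M) ≡ subst (σ ∘ ρ) M
subst-rename σ ρ (var j)   = refl
subst-rename σ ρ (app M N) = cong₂ app (subst-rename σ ρ M) (subst-rename σ ρ N)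
subst-rename σ ρ (lam M)   = cong lam (trans (subst-rename (exts σ) (ext ρ) M)
  (subst-cong (λ { zero → refl ; (suc j) → refl }) M))

subst-subst : ∀ σ τ M → subst σ (subst τ M) ≡ subst (subst σ ∘ τ) M
subst-subst σ τ (var j)   = refl
subst-subst σ τ (app M N) = cong₂ app (subst-subst σ τ M) (subst-subst σ τ N)
subst-subst σ τ (lam M)   = cong lam (trans (subst-subst (exts σ) (exts τ) M)
  (subst-cong (λ { zero → refl ; (suc j) → trans (subst-rename (exts σ) suc (τ j))
                                              (sym (rename-subst suc σ (τ j))) }) M))

rename-id : ∀ {ρ} → ρ ≗ id → ∀ M → rename ρ M ≡ M
rename-id e (var j)   = cong var (e j)
rename-id e (app M N) = cong₂ app (rename-id e M) (rename-id e N)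
rename-id e (lam M)   = cong lam (rename-id (λ { zero → refl ; (suc j) → cong suc (e j) }) M)

subst-var : ∀ {σ} → σ ≗ var → ∀ M → subst σ M ≡ M
subst-var e (var j)   = e j
subst-var e (app M N) = cong₂ app (subst-var e M) (subst-var e N)
subst-var e (lam M)   = cong lam (subst-var (λ { zero → refl ; (suc j) → cong (rename suc) (e j) }) M)

rename-single : ∀ ρ N M →
  rename ρ (subst (single N) M) ≡ subst (single (rename ρ N)) (rename (ext ρ) M)
rename-single ρ N M = trans (rename-subst ρ (single N) M)
  (trans (subst-cong (λ { zero → refl ; (suc j) → refl }) M)
         (sym (subst-rename (single (rename ρ N)) (ext ρ) M)))

subst-single : ∀ σ N M →
  subst σ (subst (single N) M) ≡ subst (single (subst σ N)) (subst (exts σ) M)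
subst-single σ N M = trans (subst-subst σ (single N) M)
  (trans (subst-cong (λ { zero → refl
                        ; (suc j) → sym (trans (subst-rename (single (subst σ N)) suc (σ j))
                                               (subst-var (λ _ → refl) (σ j))) }) M)
         (sym (subst-subst (single (subst σ N)) (exts σ) M)))

-- Church–Rosser for β, by Takahashi's parallel reduction

infix 4 _⇛_
data _⇛_ : Term → Term → Set where
  pvar  : ∀ {x} → var x ⇛ var x
  plam  : ∀ {M M'} → M ⇛ M' → lam M ⇛ lam M'
  papp  : ∀ {M M' N N'} → M ⇛ M' → N ⇛ N' → app M N ⇛ app M' N'
  pbeta : ∀ {M M' N N'} → M ⇛ M' → N ⇛ N' → app (lam M) N ⇛ subst (single N') M'

par-refl : ∀ M → M ⇛ M
par-refl (var x)   = pvar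
par-refl (app M N) = papp (par-refl M) (par-refl N)
par-refl (lam M)   = plam (par-refl M)

par-rename : ∀ ρ {M M'} → M ⇛ M' → rename ρ M ⇛ rename ρ M'
par-rename ρ pvar       = pvar
par-rename ρ (plam p)   = plam (par-rename (ext ρ) p)
par-rename ρ (papp p q) = papp (par-rename ρ p) (par-rename ρ q)
par-rename ρ (pbeta {M' = M'} {N' = N'} p q) =
  transport (_ ⇛_) (sym (rename-single ρ N' M')) (pbeta (par-rename (ext ρ) p) (par-rename ρ q))

par-subst : ∀ {σ σ'} → (∀ x → σ x ⇛ σ' x) → ∀ {M M'} → M ⇛ M' → subst σ M ⇛ subst σ' M'
par-subst e pvar       = e _
par-subst e (plam p)   = plam (par-subst (λ { zero → pvar ; (suc j) → par-rename suc (e j) }) p)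
par-subst e (papp p q) = papp (par-subst e p) (par-subst e q)
par-subst {σ' = σ'} e (pbeta {M' = M'} {N' = N'} p q) =
  transport (_ ⇛_) (sym (subst-single σ' N' M'))
    (pbeta (par-subst (λ { zero → pvar ; (suc j) → par-rename suc (e j) }) p) (par-subst e q))

par-single : ∀ {M M' N N'} → M ⇛ M' → N ⇛ N' → subst (single N) M ⇛ subst (single N') M'
par-single p q = par-subst (λ { zero → q ; (suc j) → pvar }) p

develop : Term → Term
develop (var x)            = var x
develop (lam M)            = lam (develop M)
develop (app (var x) N)    = app (var x) (develop N)
develop (app (app M M') N) = app (develop (app M M')) (develop N)
develop (app (lam M) N)    = subst (single (develop N)) (develop M)

triangle : ∀ {M N} → M ⇛ N → N ⇛ develop M
triangle pvar                          = pvar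
triangle (plam p)                      = plam (triangle p)
triangle (papp {M = var x} pvar q)     = papp pvar (triangle q)
triangle (papp {M = app M M'} p q)     = papp (triangle p) (triangle q)
triangle (papp {M = lam M} (plam p) q) = pbeta (triangle p) (triangle q)
triangle (pbeta p q)                   = par-single (triangle p) (triangle q)

strip : ∀ {M N₁ N₂} → M ⇛ N₁ → Star _⇛_ M N₂ → Σ Term λ W → Star _⇛_ N₁ W × N₂ ⇛ W
strip {N₁ = N₁} p ε = N₁ , ε , p
strip p (q ◅ qs) with strip (triangle q) qs
... | W , r , s = W , triangle p ◅ r , s

par-confluent : ∀ {M N₁ N₂} → Star _⇛_ M N₁ → Star _⇛_ M N₂ →
  Σ Term λ W → Star _⇛_ N₁ W × Star _⇛_ N₂ W
par-confluent {N₂ = N₂} ε qs = N₂ , qs , ε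
par-confluent (p ◅ ps) qs with strip p qs
... | W₁ , r , s with par-confluent ps r
... | W , a , b = W , a , s ◅ b

↠β-lam : ∀ {M M'} → M ↠β M' → lam M ↠β lam M'
↠β-lam = gmap lam lamξ

↠β-app : ∀ {M M' N N'} → M ↠β M' → N ↠β N' → app M N ↠β app M' N'
↠β-app p q = gmap (λ M → app M _) appL p ◅◅ gmap (app _) appR q

step⇒par : ∀ {M N} → M →β N → M ⇛ N
step⇒par (β {M} {N}) = pbeta (par-refl M) (par-refl N)
step⇒par (appL s)    = papp (step⇒par s) (par-refl _)
step⇒par (appR s)    = papp (par-refl _) (step⇒par s)
step⇒par (lamξ s)    = plam (step⇒par s)

par⇒↠β : ∀ {M N} → M ⇛ N → M ↠β N
par⇒↠β pvar        = ε
par⇒↠β (plam p)    = ↠β-lam (par⇒↠β p)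
par⇒↠β (papp p q)  = ↠β-app (par⇒↠β p) (par⇒↠β q)
par⇒↠β (pbeta p q) = ↠β-app (↠β-lam (par⇒↠β p)) (par⇒↠β q) ◅◅ (β ◅ ε)

pars⇒↠β : ∀ {M N} → Star _⇛_ M N → M ↠β N
pars⇒↠β ε        = ε
pars⇒↠β (p ◅ ps) = par⇒↠β p ◅◅ pars⇒↠β ps

church-rosser : ∀ {M N₁ N₂} → M ↠β N₁ → M ↠β N₂ → Σ Term λ W → N₁ ↠β W × N₂ ↠β W
church-rosser p q with par-confluent (gmap id step⇒par p) (gmap id step⇒par q)
... | W , a , b = W , pars⇒↠β a , pars⇒↠β b

Joinable : Term → Term → Set
Joinable A B = Σ Term λ Z → A ↠β Z × B ↠β Z

rename-→β : ∀ ρ {M N} → M →β N → rename ρ M →β rename ρ N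
rename-→β ρ (β {M} {N}) =
  transport (app (lam (rename (ext ρ) M)) (rename ρ N) →β_) (sym (rename-single ρ N M)) β
rename-→β ρ (appL s) = appL (rename-→β ρ s)
rename-→β ρ (appR s) = appR (rename-→β ρ s)
rename-→β ρ (lamξ s) = lamξ (rename-→β (ext ρ) s)

rename-↠β : ∀ ρ {M N} → M ↠β N → rename ρ M ↠β rename ρ N
rename-↠β ρ = gmap (rename ρ) (rename-→β ρ)

rename-→β-reflect : ∀ ρ M {P} → rename ρ M →β P → Σ Term λ M' → M →β M' × P ≡ rename ρ M'
rename-→β-reflect ρ (lam M) (lamξ s) with rename-→β-reflect (ext ρ) M s
... | M' , s' , e = lam M' , lamξ s' , cong lam e
rename-→β-reflect ρ (app (var x) B) (appR s) with rename-→β-reflect ρ B s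
... | B' , s' , e = app (var x) B' , appR s' , cong (app _) e
rename-→β-reflect ρ (app (app A₁ A₂) B) (appL s) with rename-→β-reflect ρ (app A₁ A₂) s
... | A' , s' , e = app A' B , appL s' , cong (λ X → app X _) e
rename-→β-reflect ρ (app (app A₁ A₂) B) (appR s) with rename-→β-reflect ρ B s
... | B' , s' , e = app (app A₁ A₂) B' , appR s' , cong (app _) e
rename-→β-reflect ρ (app (lam A) B) β = subst (single B) A , β , sym (rename-single ρ B A)
rename-→β-reflect ρ (app (lam A) B) (appL s) with rename-→β-reflect ρ (lam A) s
... | A' , s' , e = app A' B , appL s' , cong (λ X → app X _) e
rename-→β-reflect ρ (app (lam A) B) (appR s) with rename-→β-reflect ρ B s
... | B' , s' , e = app (lam A) B' , appR s' , cong (app _) e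

rename-↠β-reflect : ∀ ρ M {P} → rename ρ M ↠β P → Σ Term λ M' → M ↠β M' × P ≡ rename ρ M'
rename-↠β-reflect ρ M ε = M , ε , refl
rename-↠β-reflect ρ M (s ◅ ss) with rename-→β-reflect ρ M s
... | M₁ , s₁ , refl with rename-↠β-reflect ρ M₁ ss
... | M₂ , s₂ , e = M₂ , s₁ ◅ s₂ , e

-- Head normal forms  λx₁…xₙ. y M₁ ⋯ Mₖ  (written lams n (apps y Ms))

-- ℕ-indexed list lookup, total by a dummy default; it is only used below
-- the length of the list.
at : List Term → ℕ → Term
at []       _       = var 0
at (M ∷ Ms) zero    = M
at (M ∷ Ms) (suc j) = at Ms j

at-lookup : ∀ Ms (j : Fin (length Ms)) → lookup Ms j ≡ at Ms (toℕ j)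
at-lookup (M ∷ Ms) Fin.zero    = refl
at-lookup (M ∷ Ms) (Fin.suc j) = at-lookup Ms j

at-map : ∀ f Ms j → j < length Ms → at (map f Ms) j ≡ f (at Ms j)
at-map f (M ∷ Ms) zero    _         = refl
at-map f (M ∷ Ms) (suc j) (s≤s lt) = at-map f Ms j lt

Pointwise-at : ∀ {R : Term → Term → Set} {As Bs} → Pointwise R As Bs →
  ∀ j → j < length As → R (at As j) (at Bs j)
Pointwise-at (r ∷ rs) zero    _         = r
Pointwise-at (r ∷ rs) (suc j) (s≤s lt) = Pointwise-at rs j lt

-- foldl-style application: the last argument is outermost.
apps-snoc : ∀ A Bs B → foldl app A (Bs ++ B ∷ []) ≡ app (foldl app A Bs) B
apps-snoc A Bs B = foldl-++ app A Bs (B ∷ [])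

data Neutral : Term → Set where
  nvar : ∀ {x} → Neutral (var x)
  napp : ∀ {A B} → Neutral A → Neutral (app A B)

data HeadNormal : Term → Set where
  hneu : ∀ {A} → Neutral A → HeadNormal A
  hlam : ∀ {A} → HeadNormal A → HeadNormal (lam A)

-- M has a head normal form; BT(M) = ⊥ exactly when it has none.
HasHnf : Term → Set
HasHnf M = Σ ℕ λ n → Σ ℕ λ h → Σ (List Term) λ Ms → M ↠β lams n (apps h Ms)

neutral-apps : ∀ {A} Bs → Neutral A → Neutral (foldl app A Bs)
neutral-apps []       n = n
neutral-apps (B ∷ Bs) n = neutral-apps Bs (napp n)

headNormal-hnf : ∀ n h Ms → HeadNormal (lams n (apps h Ms))
headNormal-hnf zero    h Ms = hneu (neutral-apps Ms nvar)
headNormal-hnf (suc n) h Ms = hlam (headNormal-hnf n h Ms)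

neutral-form : ∀ {A} → Neutral A → Σ ℕ λ h → Σ (List Term) λ Ms → A ≡ apps h Ms
neutral-form (nvar {x}) = x , [] , refl
neutral-form (napp {B = B} n) with neutral-form n
... | h , Ms , refl = h , Ms ++ B ∷ [] , sym (apps-snoc (var h) Ms B)

headNormal-form : ∀ {A} → HeadNormal A →
  Σ ℕ λ n → Σ ℕ λ h → Σ (List Term) λ Ms → A ≡ lams n (apps h Ms)
headNormal-form (hneu n) with neutral-form n
... | h , Ms , e = 0 , h , Ms , e
headNormal-form (hlam H) with headNormal-form H
... | n , h , Ms , e = suc n , h , Ms , cong lam e

neutral-unrename : ∀ ρ A → Neutral (rename ρ A) → Neutral A
neutral-unrename ρ (var x)   n        = nvar
neutral-unrename ρ (app A B) (napp n) = napp (neutral-unrename ρ A n)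

headNormal-unrename : ∀ ρ A → HeadNormal (rename ρ A) → HeadNormal A
headNormal-unrename ρ (var x)   _        = hneu nvar
headNormal-unrename ρ (app A B) (hneu n) = hneu (neutral-unrename ρ (app A B) n)
headNormal-unrename ρ (lam A)   (hlam h) = hlam (headNormal-unrename (ext ρ) A h)

-- ... hence so is having a head normal form: a reduction of rename ρ M is
-- the renaming of a reduction of M.
hasHnf-unrename : ∀ ρ M {P} → rename ρ M ↠β P → HeadNormal P → HasHnf M
hasHnf-unrename ρ M r H with rename-↠β-reflect ρ M r
... | M' , r' , e with headNormal-form (headNormal-unrename ρ M' (transport HeadNormal e H))
... | n , h , Ms , e' = n , h , Ms , transport (M ↠β_) e' r'

extN-ext : ∀ n ρ → extN n (ext ρ) ≗ ext (extN n ρ)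
extN-ext zero    ρ j = refl
extN-ext (suc n) ρ   = ext-cong (extN-ext n ρ)

rename-apps : ∀ ρ A Bs → rename ρ (foldl app A Bs) ≡ foldl app (rename ρ A) (map (rename ρ) Bs)
rename-apps ρ A []       = refl
rename-apps ρ A (B ∷ Bs) = rename-apps ρ (app A B) Bs

rename-lams : ∀ n ρ A → rename ρ (lams n A) ≡ lams n (rename (extN n ρ) A)
rename-lams zero    ρ A = refl
rename-lams (suc n) ρ A =
  cong lam (trans (rename-lams n (ext ρ) A) (cong (lams n) (rename-cong (extN-ext n ρ) A)))

rename-hnf : ∀ ρ n h Ms →
  rename ρ (lams n (apps h Ms)) ≡ lams n (apps (extN n ρ h) (map (rename (extN n ρ)) Ms))
rename-hnf ρ n h Ms = trans (rename-lams n ρ (apps h Ms)) (cong (lams n) (rename-apps (extN n ρ) (var h) Ms))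

neutral-→β : ∀ {A A'} → Neutral A → A →β A' → Neutral A'
neutral-→β (napp n) (appL s) = napp (neutral-→β n s)
neutral-→β (napp n) (appR s) = napp n

neutral-↠β : ∀ {A A'} → Neutral A → A ↠β A' → Neutral A'
neutral-↠β n ε        = n
neutral-↠β n (s ◅ ss) = neutral-↠β (neutral-→β n s) ss

neutral-app-↠β : ∀ {A B Z} → Neutral A → app A B ↠β Z →
  Σ Term λ A' → Σ Term λ B' → Z ≡ app A' B' × A ↠β A' × B ↠β B'
neutral-app-↠β n ε = _ , _ , refl , ε , ε
neutral-app-↠β n (appL s ◅ ss) with neutral-app-↠β (neutral-→β n s) ss
... | A' , B' , e , a , b = A' , B' , e , s ◅ a , b
neutral-app-↠β n (appR s ◅ ss) with neutral-app-↠β n ss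
... | A' , B' , e , a , b = A' , B' , e , a , s ◅ b

neutral-apps-↠β : ∀ Bs {A Z} → Neutral A → foldl app A Bs ↠β Z →
  Σ Term λ A' → Σ (List Term) λ Bs' → Z ≡ foldl app A' Bs' × A ↠β A' × Pointwise _↠β_ Bs Bs'
neutral-apps-↠β []       n r = _ , [] , refl , r , []
neutral-apps-↠β (B ∷ Bs) n r with neutral-apps-↠β Bs (napp n) r
... | A'' , Bs' , e , r₁ , rs with neutral-app-↠β n r₁
... | A' , B' , refl , a , b = A' , B' ∷ Bs' , e , a , b ∷ rs

var-↠β : ∀ {x Z} → var x ↠β Z → Z ≡ var x
var-↠β ε        = refl
var-↠β (() ◅ _)

lam-↠β : ∀ {A Z} → lam A ↠β Z → Σ Term λ A' → Z ≡ lam A' × A ↠β A'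
lam-↠β ε = _ , refl , ε
lam-↠β (lamξ s ◅ ss) with lam-↠β ss
... | A' , e , r = A' , e , s ◅ r

lam-↠β-lam : ∀ {A B} → lam A ↠β lam B → A ↠β B
lam-↠β-lam r with lam-↠β r
... | _ , refl , r' = r'

lams-↠β : ∀ n {A Z} → lams n A ↠β Z → Σ Term λ A' → Z ≡ lams n A' × A ↠β A'
lams-↠β zero    r = _ , refl , r
lams-↠β (suc n) r with lam-↠β r
... | B , refl , r' with lams-↠β n r'
... | A' , refl , r'' = A' , refl , r''

hnf-↠β : ∀ n h As {Z} → lams n (apps h As) ↠β Z →
  Σ (List Term) λ Bs → Z ≡ lams n (apps h Bs) × Pointwise _↠β_ As Bs
hnf-↠β n h As r with lams-↠β n r
... | A' , refl , r' with neutral-apps-↠β As nvar r'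
... | A'' , Bs , refl , a , rs with var-↠β a
... | refl = Bs , refl , rs

binderCount : Term → ℕ
binderCount (lam M) = suc (binderCount M)
binderCount _       = zero

matrix : Term → Term
matrix (lam M) = matrix M
matrix M       = M

headOf : Term → Term
headOf (app A B) = headOf A
headOf M         = M

argsOf : Term → List Term
argsOf (app A B) = argsOf A ++ B ∷ []
argsOf _         = []

headOf-apps : ∀ A Bs → headOf (foldl app A Bs) ≡ headOf A
headOf-apps A []       = refl
headOf-apps A (B ∷ Bs) = headOf-apps (app A B) Bs

argsOf-apps : ∀ A Bs → argsOf (foldl app A Bs) ≡ argsOf A ++ Bs
argsOf-apps A []       = sym (++-identityʳ (argsOf A))
argsOf-apps A (B ∷ Bs) = trans (argsOf-apps (app A B) Bs) (++-assoc (argsOf A) (B ∷ []) Bs)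

neutral-binderCount : ∀ {A} → Neutral A → binderCount A ≡ 0
neutral-binderCount nvar     = refl
neutral-binderCount (napp n) = refl

neutral-matrix : ∀ {A} → Neutral A → matrix A ≡ A
neutral-matrix nvar     = refl
neutral-matrix (napp n) = refl

binderCount-hnf : ∀ n h As → binderCount (lams n (apps h As)) ≡ n
binderCount-hnf zero    h As = neutral-binderCount (neutral-apps As nvar)
binderCount-hnf (suc n) h As = cong suc (binderCount-hnf n h As)

matrix-hnf : ∀ n h As → matrix (lams n (apps h As)) ≡ apps h As
matrix-hnf zero    h As = neutral-matrix (neutral-apps As nvar)
matrix-hnf (suc n) h As = matrix-hnf n h As

hnf-injective : ∀ {n n' h h' As As'} → lams n (apps h As) ≡ lams n' (apps h' As') →
  n ≡ n' × h ≡ h' × As ≡ As'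
hnf-injective {n} {n'} {h} {h'} {As} {As'} e =
  trans (sym (binderCount-hnf n h As)) (trans (cong binderCount e) (binderCount-hnf n' h' As')) ,
  var-injective (trans (sym (headOf-apps (var h) As)) (trans (cong headOf e-apps) (headOf-apps (var h') As'))) ,
  trans (sym (argsOf-apps (var h) As)) (trans (cong argsOf e-apps) (argsOf-apps (var h') As'))
  where
  e-apps : apps h As ≡ apps h' As'
  e-apps = trans (sym (matrix-hnf n h As)) (trans (cong matrix e) (matrix-hnf n' h' As'))
  var-injective : ∀ {a b} → var a ≡ var b → a ≡ b
  var-injective refl = refl

-- By Church–Rosser, two head normal forms of one term agree in their number
-- of binders and head, and have pairwise joinable arguments.
hnf-unique : ∀ {M n n' h h' As As'} → M ↠β lams n (apps h As) → M ↠β lams n' (apps h' As') →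
  n ≡ n' × h ≡ h' × Pointwise Joinable As As'
hnf-unique {n = n} {n'} {h} {h'} {As} {As'} r r' with church-rosser r r'
... | W , w , w' with hnf-↠β n h As w | hnf-↠β n' h' As' w'
... | Bs , refl , rs | Bs' , e , rs' with hnf-injective {n} {n'} {h} {h'} {Bs} {Bs'} e
... | refl , refl , refl = refl , refl , joinable-pointwise rs rs'
  where
  joinable-pointwise : ∀ {As As' Bs} → Pointwise _↠β_ As Bs → Pointwise _↠β_ As' Bs →
    Pointwise Joinable As As'
  joinable-pointwise []       []         = []
  joinable-pointwise (r ∷ rs) (r' ∷ rs') = (_ , r , r') ∷ joinable-pointwise rs rs'

extN-low : ∀ n ρ z → z < n → extN n ρ z ≡ z
extN-low (suc n) ρ zero    _         = refl
extN-low (suc n) ρ (suc z) (s≤s lt) = cong suc (extN-low n ρ z lt)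

extN-high : ∀ n ρ x → extN n ρ (n + x) ≡ n + ρ x
extN-high zero    ρ x = refl
extN-high (suc n) ρ x = cong suc (extN-high n ρ x)

extN-+ : ∀ a c ρ → extN (a + c) ρ ≗ extN a (extN c ρ)
extN-+ zero    c ρ j = refl
extN-+ (suc a) c ρ   = ext-cong (extN-+ a c ρ)

extN-high⁻¹ : ∀ n ρ h x → extN n ρ h ≡ n + x → Σ ℕ λ y → h ≡ n + y × ρ y ≡ x
extN-high⁻¹ zero    ρ h       x e = h , refl , e
extN-high⁻¹ (suc n) ρ (suc h) x e with extN-high⁻¹ n ρ h x (suc-injective e)
... | y , refl , e' = y , refl , e'

extN-low⁻¹ : ∀ n ρ y z → extN n ρ y ≡ z → z < n → y ≡ z
extN-low⁻¹ (suc n) ρ zero    z       e _         = e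
extN-low⁻¹ (suc n) ρ (suc y) (suc z) e (s≤s lt) = cong suc (extN-low⁻¹ n ρ y z (suc-injective e) lt)

pull-self : ∀ k → pull k k ≡ 0
pull-self k with k ≡ᵇ k | ≡⇒≡ᵇ k k refl
... | true | _ = refl

pull≡0 : ∀ k z → pull k z ≡ 0 → z ≡ k
pull≡0 k z e with z ≡ᵇ k | ≡ᵇ⇒≡ z k
... | true  | sound = sound tt
pull≡0 k z () | false | _

maxF-upper : ∀ m (f : Fin m → ℕ) j → f j ≤ maxF m f
maxF-upper (suc m) f Fin.zero    = m≤m⊔n _ _
maxF-upper (suc m) f (Fin.suc j) = ≤-trans (maxF-upper m (f ∘ Fin.suc) j) (m≤n⊔m _ _)

maxF-least : ∀ m (f : Fin m → ℕ) B → (∀ j → f j ≤ B) → maxF m f ≤ B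
maxF-least zero    f B h = z≤n
maxF-least (suc m) f B h = ⊔-lub (h Fin.zero) (maxF-least m (f ∘ Fin.suc) B (h ∘ Fin.suc))

-- Böhm trees

label-injective : ∀ {a b c a' b' c'} → just (lbl a b c) ≡ just (lbl a' b' c') →
  a ≡ a' × b ≡ b' × c ≡ c'
label-injective refl = refl , refl , refl

just≢nothing : ∀ {A : Set} {a : A} → just a ≢ nothing
just≢nothing ()

child-BT : ∀ {R : Term → Tree → Set} {T Ms} →
  (∀ (j : Fin (length Ms)) → R (lookup Ms j) (sub T (toℕ j))) →
  (∀ M' T' → R M' T' → BTStep R M' T') → ∀ j → j < length Ms → IsBT (at Ms j) (sub T j)
child-BT {R} {T} {Ms} kids post j lt =
  transport (λ X → IsBT X (sub T j)) (trans (at-lookup Ms (fromℕ< lt)) (cong (at Ms) (toℕ-fromℕ< lt)))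
    (transport (λ i → IsBT (lookup Ms (fromℕ< lt)) (sub T i)) (toℕ-fromℕ< lt)
      (R , kids (fromℕ< lt) , post))

relabel : (ℕ → ℕ) → ℕ → Maybe Label → Maybe Label
relabel ρ b nothing            = nothing
relabel ρ b (just (lbl n h k)) = just (lbl n (extN (b + n) ρ h) k)

renT-relabel : ∀ ρ T π → renT ρ T π ≡ relabel ρ (bAbove T π) (T π)
renT-relabel ρ T π with T π
... | nothing         = refl
... | just (lbl n h k) = refl

rootBinders-lbl : ∀ T {n h k} → T [] ≡ just (lbl n h k) → rootBinders T ≡ n
rootBinders-lbl T e with T []
rootBinders-lbl T refl | just (lbl n h k) = refl

relabel-cong : ∀ {ρ ρ'} b b' → (∀ n → extN (b + n) ρ ≗ extN (b' + n) ρ') →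
  ∀ X → relabel ρ b X ≡ relabel ρ' b' X
relabel-cong b b' h nothing            = refl
relabel-cong b b' h (just (lbl n x k)) = cong (λ z → just (lbl n z k)) (h n x)

renT-sub : ∀ ρ T {m h k} → T [] ≡ just (lbl m h k) → ∀ j π →
  renT ρ T (j ∷ π) ≡ renT (extN m ρ) (sub T j) π
renT-sub ρ T {m} e j π = begin
  renT ρ T (j ∷ π)
    ≡⟨ renT-relabel ρ T (j ∷ π) ⟩
  relabel ρ (rootBinders T + b) (T (j ∷ π))
    ≡⟨ cong (λ c → relabel ρ (c + b) (T (j ∷ π))) (rootBinders-lbl T e) ⟩
  relabel ρ (m + b) (T (j ∷ π))
    ≡⟨ relabel-cong (m + b) b shift (T (j ∷ π)) ⟩
  relabel (extN m ρ) b (T (j ∷ π))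
    ≡⟨ sym (renT-relabel (extN m ρ) (sub T j) π) ⟩
  renT (extN m ρ) (sub T j) π ∎
  where
  open ≡-Reasoning
  b = bAbove (sub T j) π
  shift : ∀ n → extN (m + b + n) ρ ≗ extN (b + n) (extN m ρ)
  shift n z = trans (cong (λ q → extN q ρ z) (trans (+-assoc m b n) (+-comm m (b + n))))
                    (extN-+ (b + n) m ρ z)

-- η-expansion trees

data EtaTree : ℕ → ℕ → Tree → Set where
  eta-node : ∀ {s x T} m → T [] ≡ just (lbl m (m + x) m) → m ≤ s →
             (∀ j → j < m → Σ ℕ λ t → t < s × EtaTree t (m ∸ suc j) (sub T j)) →
             EtaTree s x T

mirror< : ∀ {j m} → j < m → m ∸ suc j < m
mirror< lt = ∸-monoʳ-< z<s lt

etaTree-head-free : ∀ {s x T} → EtaTree s x T → FreeIn x T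
etaTree-head-free (eta-node m root _ _) = here root refl

relabel-root⁻¹ : ∀ ρ X {m x k} → relabel ρ 0 X ≡ just (lbl m (m + x) k) →
  Σ ℕ λ y → X ≡ just (lbl m (m + y) k) × ρ y ≡ x
relabel-root⁻¹ ρ (just (lbl n h k)) {x = x} e with label-injective e
... | refl , eh , refl with extN-high⁻¹ n ρ h x eh
... | y , refl , ρy = y , refl , ρy

-- If a renaming of T is an η-expansion tree of x, then T is one of a
-- preimage of x.  (Stated up to pointwise equality of trees, the form in
-- which renT commutes with subtrees.)
etaTree-unrename : ∀ ρ {s x T' T} → EtaTree s x T' → (∀ π → T' π ≡ renT ρ T π) →
  Σ ℕ λ y → ρ y ≡ x × EtaTree s y T
etaTree-unrename ρ {s} {T = T} (eta-node m root m≤s children) e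
  with relabel-root⁻¹ ρ (T []) (trans (sym (trans (e []) (renT-relabel ρ T []))) root)
... | y , rootT , ρy = y , ρy , eta-node m rootT m≤s children'
  where
  children' : ∀ j → j < m → Σ ℕ λ t → t < s × EtaTree t (m ∸ suc j) (sub T j)
  children' j lt with children j lt
  ... | t , t<s , E
    with etaTree-unrename (extN m ρ) E (λ π → trans (e (j ∷ π)) (renT-sub ρ T rootT j π))
  ... | y' , ey , E' with extN-low⁻¹ m ρ y' (m ∸ suc j) ey (mirror< lt)
  ... | refl = t , t<s , E'

-- From terms of bounded size to η-expansion trees

Joinable-lam-rename : ∀ ρ {A B} → Joinable A B → Joinable (lam (rename ρ A)) (lam (rename ρ B))
Joinable-lam-rename ρ (Z , a , b) = lam (rename ρ Z) , ↠β-lam (rename-↠β ρ a) , ↠β-lam (rename-↠β ρ b)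

lamZ-at : ∀ Qs (j : Fin (length Qs)) →
  lamZ Qs j ≡ lam (rename (pull (length Qs ∸ suc (toℕ j))) (at Qs (toℕ j)))
lamZ-at Qs j = cong (λ Q → lam (rename (pull (length Qs ∸ suc (toℕ j))) Q)) (at-lookup Qs j)

lamZ-at-fromℕ< : ∀ Qs {j} (lt : j < length Qs) →
  lamZ Qs (fromℕ< lt) ≡ lam (rename (pull (length Qs ∸ suc j)) (at Qs j))
lamZ-at-fromℕ< Qs {j} lt =
  trans (lamZ-at Qs (fromℕ< lt))
        (cong (λ i → lam (rename (pull (length Qs ∸ suc i)) (at Qs i))) (toℕ-fromℕ< lt))

joinable-hnf : ∀ {L N} n h As → L ↠β lams n (apps h As) → Joinable L N →
  Σ (List Term) λ Bs → N ↠β lams n (apps h Bs) × Pointwise _↠β_ As Bs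
joinable-hnf n h As r (Z , a , b) with church-rosser r a
... | W , w , w' with hnf-↠β n h As w
... | Bs , refl , rs = Bs , b ◅◅ w' , rs

-- What BT(M) looks like when λ.(ρ M) is joinable with λy z₁…zₘ. y Q₁ ⋯ Qₘ:
-- its root is λz₁…zₘ. x M₁ ⋯ Mₘ with ρ x = y, where BT(Mⱼ) is the j-th
-- subtree and Qⱼ is joinable with Mⱼ renamed under the m binders.
record HeadMatch (ρ : ℕ → ℕ) (T : Tree) (Qs : List Term) : Set₁ where
  field
    headVar       : ℕ
    headVar↦0     : ρ headVar ≡ 0
    args          : List Term
    root          : T [] ≡ just (lbl (length Qs) (length Qs + headVar) (length Qs))
    args-BT       : ∀ j → j < length Qs → IsBT (at args j) (sub T j)
    args-joinable : ∀ j → j < length Qs →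
                    Joinable (at Qs j) (rename (extN (length Qs) ρ) (at args j))

headMatch : ∀ {L ρ M T} Qs → L ↠β lams (suc (length Qs)) (apps (length Qs) Qs) →
  Joinable L (lam (rename ρ M)) → IsBT M T → HeadMatch ρ T Qs
headMatch {ρ = ρ} {M} {T} Qs r J (R , rMT , post) with joinable-hnf (suc (length Qs)) (length Qs) Qs r J
... | Bs , rM , Qs↠Bs with post M T rMT
... | inj₁ (noHnf , _) =
  ⊥-elim (noHnf (hasHnf-unrename ρ M (lam-↠β-lam rM) (headNormal-hnf (length Qs) (length Qs) Bs)))
... | inj₂ (n , h , Ms , red , rootT , kids)
  with hnf-unique {n = n} {length Qs} {extN n ρ h} {length Qs} {map (rename (extN n ρ)) Ms} {Bs}
         (transport (rename ρ M ↠β_) (rename-hnf ρ n h Ms) (rename-↠β ρ red)) (lam-↠β-lam rM)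
... | refl , eh , joins with extN-high⁻¹ n ρ h 0 (trans eh (sym (+-identityʳ n)))
... | y , refl , ρy = record
  { headVar       = y
  ; headVar↦0     = ρy
  ; args          = Ms
  ; root          = trans rootT (cong (λ k → just (lbl n (n + y) k)) length-Ms)
  ; args-BT       = λ j lt → child-BT {T = T} {Ms = Ms} kids post j (ltMs lt)
  ; args-joinable = joinable
  }
  where
  f = rename (extN n ρ)
  length-Ms : length Ms ≡ n
  length-Ms = trans (sym (length-map f Ms))
                    (trans (Pointwise-length joins) (sym (Pointwise-length Qs↠Bs)))
  ltMs : ∀ {j} → j < n → j < length Ms
  ltMs = transport (_ <_) (sym length-Ms)
  joinable : ∀ j → j < n → Joinable (at Qs j) (f (at Ms j))
  joinable j lt with Pointwise-at joins j (transport (j <_) (sym (length-map f Ms)) (ltMs lt))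
  ... | Z , a , b = Z , Pointwise-at Qs↠Bs j lt ◅◅ b , transport (_↠β Z) (at-map f Ms j (ltMs lt)) a

-- The renaming ρ is needed for the recursion into the arguments λzⱼ.Qⱼ.
etaTree-of-size : ∀ {L s} → Size L s → ∀ ρ M T → Joinable L (lam (rename ρ M)) → IsBT M T →
  Σ ℕ λ x → ρ x ≡ 0 × EtaTree s x T
etaTree-of-size (size-id r) ρ M T J bt = headVar , headVar↦0 , eta-node 0 root z≤n (λ _ ())
  where open HeadMatch (headMatch [] r J bt)
etaTree-of-size (size-hnf Qs sz _ r kids) ρ M T J bt =
  headVar , headVar↦0 , eta-node m root (m≤m⊔n _ _) children
  where
  open HeadMatch (headMatch Qs r J bt)
  m = length Qs
  -- λzⱼ.Qⱼ is joinable with λzⱼ.Mⱼ, both renamed to make zⱼ the outermost variable.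
  argJoinable : ∀ j (lt : j < m) →
    Joinable (lamZ Qs (fromℕ< lt)) (lam (rename (pull (m ∸ suc j) ∘ extN m ρ) (at args j)))
  argJoinable j lt =
    transport₂ Joinable (sym (lamZ-at-fromℕ< Qs lt))
      (cong lam (rename-rename (pull (m ∸ suc j)) (extN m ρ) (at args j)))
      (Joinable-lam-rename (pull (m ∸ suc j)) (args-joinable j lt))
  children : ∀ j → j < m → Σ ℕ λ t → t < m ⊔ suc (maxF m sz) × EtaTree t (m ∸ suc j) (sub T j)
  children j lt
    with etaTree-of-size (kids (fromℕ< lt)) (pull (m ∸ suc j) ∘ extN m ρ) (at args j) (sub T j)
           (argJoinable j lt) (args-BT j lt)
  ... | y , ey , E with extN-low⁻¹ m ρ y (m ∸ suc j) (pull≡0 _ _ ey) (mirror< lt)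
  ... | refl = sz (fromℕ< lt) , ≤-trans (s≤s (maxF-upper m sz (fromℕ< lt))) (m≤n⊔m m _) , E

etaTree-of-lam : ∀ {L M T s} → Size L s → L ↠β lam M → IsBT M T → EtaTree s 0 T
etaTree-of-lam {M = M} {T} size r bt
  with etaTree-of-size size id M T (lam M , r , transport (_↠β lam M) (sym lamM≡) ε) bt
  where lamM≡ = cong lam (rename-id (λ _ → refl) M)
... | _ , refl , E = E

-- The extra arguments of ≤η: Böhm trees of terms in ETA_p

size-hasHnf : ∀ {M s} → Size M s → HasHnf M
size-hasHnf (size-id r)            = 1 , 0 , [] , r
size-hasHnf (size-hnf Qs _ _ r _) = suc (length Qs) , length Qs , Qs , r

BTStep-mono : ∀ {R R' : Term → Tree → Set} {M T} → (∀ A B → R A B → R' A B) →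
  BTStep R M T → BTStep R' M T
BTStep-mono h (inj₁ noHnf)                          = inj₁ noHnf
BTStep-mono h (inj₂ (n , k , Ms , r , e , kids)) = inj₂ (n , k , Ms , r , e , λ j → h _ _ (kids j))

lamT-root⁻¹ : ∀ W {n h k} → lamT W [] ≡ just (lbl n h k) →
  Σ ℕ λ n' → n ≡ suc n' × W [] ≡ just (lbl n' h k)
lamT-root⁻¹ W e with W []
lamT-root⁻¹ W refl | just (lbl n h k) = n , refl , refl

BT-unlam : ∀ {M₀ W} → IsBT M₀ (lamT W) → HasHnf M₀ → Σ Term λ M₁ → M₀ ↠β lam M₁ × IsBT M₁ W
BT-unlam {M₀} {W} (R , rM₀ , post) hnf with post M₀ (lamT W) rM₀
... | inj₁ (noHnf , _) = ⊥-elim (noHnf hnf)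
... | inj₂ (n , h , Ms , red , root , kids) with lamT-root⁻¹ W root
... | n' , refl , rootW = M₁ , red , R' , inj₂ (refl , refl) , post'
  where
  M₁ = lams n' (apps h Ms)
  -- R extended by the pair (M₁, W), whose children are those of (M₀, λz.W).
  R' : Term → Tree → Set
  R' A B = R A B ⊎ (A ≡ M₁ × B ≡ W)
  post' : ∀ A B → R' A B → BTStep R' A B
  post' A B (inj₁ rAB)           = BTStep-mono {R = R} {R' = R'} {M = A} {T = B} (λ _ _ → inj₁) (post A B rAB)
  post' A B (inj₂ (refl , refl)) = inj₂ (n' , h , Ms , ε , rootW , λ j → inj₁ (kids j))

etaTree-of-TETA : ∀ {p k W} → TETAp p (lamT (renT (pull k) W)) → Σ ℕ λ t → t < p × EtaTree t k W
etaTree-of-TETA {k = k} (M₀ , (_ , t , size , t<p) , bt) with BT-unlam bt (size-hasHnf size)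
... | M₁ , red , bt₁ with etaTree-unrename (pull k) (etaTree-of-lam size red bt₁) (λ _ → refl)
... | y , py , E with pull≡0 k y py
... | refl = t , t<p , E

-- η-expansion trees are preserved by ≤η, up to the size bound

etaTree-strengthen : ∀ {t y m V} → EtaTree t y (renT (_∸ m) V) → (∀ x → x < m → ¬ FreeIn x V) →
  EtaTree t (y + m) V
etaTree-strengthen {m = m} E fresh with etaTree-unrename (_∸ m) E (λ _ → refl)
... | y' , refl , E' = transport (λ z → EtaTree _ z _) (sym (m∸n+n≡m m≤y')) E'
  where
  m≤y' : m ≤ y'
  m≤y' with m ≤? y'
  ... | yes le = le
  ... | no ¬le = ⊥-elim (fresh y' (≰⇒> ¬le) (etaTree-head-free E'))

-- A node λx⃗.x U₁ ⋯ Uₖ of U becomes λx⃗z₁…zₘ. x V₁ ⋯ Vₖ Q₁ ⋯ Qₘ in V with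
-- m ≤ p': the Vⱼ are handled recursively (size grows by at most p') and
-- the Qᵢ are η-expansion trees of size below p' by etaTree-of-TETA.
etaTree-≤η : ∀ {p' R} → (∀ U V → R U V → LeStep p' R U V) →
  ∀ {s x U V} → EtaTree s x U → R U V → EtaTree (s + p') x V
etaTree-≤η {p'} post {s} {x} {U} {V} (eta-node k rootU k≤s children) rUV with post U V rUV
... | inj₁ (noU , _) = ⊥-elim (just≢nothing (trans (sym rootU) noU))
... | inj₂ (n , h , k' , m , eU , eV , m≤p' , oldArgs , newArgs)
  with label-injective (trans (sym rootU) eU)
... | refl , refl , refl = eta-node (k + m) rootV (+-mono-≤ k≤s m≤p') children'
  where
  rootV : V [] ≡ just (lbl (k + m) ((k + m) + x) (k + m))
  rootV = trans eV (cong (λ q → just (lbl (k + m) q (k + m)))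
            (trans (+-assoc k x m) (trans (cong (k +_) (+-comm x m)) (sym (+-assoc k m x)))))
  Child : ℕ → Set
  Child j = Σ ℕ λ t → t < s + p' × EtaTree t ((k + m) ∸ suc j) (sub V j)
  oldChild : ∀ j → j < k → Child j
  oldChild j j<k with children j j<k | oldArgs j j<k
  ... | t , t<s , E | fresh , rel =
    t + p' , +-monoˡ-< p' t<s ,
    transport (λ z → EtaTree (t + p') z (sub V j)) (sym (+-∸-comm m j<k))
      (etaTree-strengthen (etaTree-≤η post E rel) fresh)
  newChild : ∀ i → i < m → Child (k + i)
  newChild i i<m with etaTree-of-TETA (newArgs i i<m)
  ... | t , t<p' , E =
    t , ≤-trans t<p' (m≤n+m p' s) ,
    transport (λ z → EtaTree t z (sub V (k + i)))
      (trans (sym ([m+n]∸[m+o]≡n∸o k m (suc i))) (cong ((k + m) ∸_) (+-suc k i))) E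
  children' : ∀ j → j < k + m → Child j
  children' j lt with j <? k
  ... | yes j<k = oldChild j j<k
  ... | no j≮k  = transport Child (m+[n∸m]≡n k≤j)
                    (newChild (j ∸ k) (transport (j ∸ k <_) (m+n∸m≡n k m) (∸-monoˡ-< lt k≤j)))
    where k≤j = ≮⇒≥ j≮k

-- From η-expansion trees back to terms

BT-root : ∀ {M T n h k} → IsBT M T → T [] ≡ just (lbl n h k) →
  Σ (List Term) λ Ms → M ↠β lams n (apps h Ms) × length Ms ≡ k ×
                       (∀ j → j < k → IsBT (at Ms j) (sub T j))
BT-root {M} {T} (R , rMT , post) root with post M T rMT
... | inj₁ (_ , noT) = ⊥-elim (just≢nothing (trans (sym root) noT))
... | inj₂ (n , h , Ms , red , root' , kids) with label-injective (trans (sym root') root)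
... | refl , refl , refl = Ms , red , refl , child-BT {T = T} {Ms = Ms} kids post

β⇒βη : ∀ {M N} → M →β N → M →βη N
β⇒βη β        = β
β⇒βη (appL s) = appL (β⇒βη s)
β⇒βη (appR s) = appR (β⇒βη s)
β⇒βη (lamξ s) = lamξ (β⇒βη s)

↠β⇒↠βη : ∀ {M N} → M ↠β N → M ↠βη N
↠β⇒↠βη = gmap id β⇒βη

↠βη-lam : ∀ {M M'} → M ↠βη M' → lam M ↠βη lam M'
↠βη-lam = gmap lam lamξ

↠βη-lams : ∀ n {M M'} → M ↠βη M' → lams n M ↠βη lams n M'
↠βη-lams zero    r = r
↠βη-lams (suc n) r = ↠βη-lam (↠βη-lams n r)

↠βη-app : ∀ {M M' N N'} → M ↠βη M' → N ↠βη N' → app M N ↠βη app M' N'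
↠βη-app p q = gmap (λ M → app M _) appL p ◅◅ gmap (app _) appR q

↠βη-apps : ∀ Ms Ns {A A'} → length Ms ≡ length Ns →
  (∀ j → j < length Ms → at Ms j ↠βη at Ns j) → A ↠βη A' → foldl app A Ms ↠βη foldl app A' Ns
↠βη-apps []       []       _ _    r = r
↠βη-apps (M ∷ Ms) (N ∷ Ns) e args r =
  ↠βη-apps Ms Ns (suc-injective e) (λ j lt → args (suc j) (s≤s lt)) (↠βη-app r (args 0 (s≤s z≤n)))

-- z₁ ⋯ zₘ, the variables bound by m binders, outermost first.
boundVars : ℕ → List Term
boundVars zero    = []
boundVars (suc m) = var m ∷ boundVars m

boundVars-length : ∀ m → length (boundVars m) ≡ m
boundVars-length zero    = refl
boundVars-length (suc m) = cong suc (boundVars-length m)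

boundVars-at : ∀ m j → j < m → at (boundVars m) j ≡ var (m ∸ suc j)
boundVars-at (suc m) zero    _         = refl
boundVars-at (suc m) (suc j) (s≤s lt) = boundVars-at m j lt

boundVars-snoc : ∀ m → boundVars (suc m) ≡ map (rename suc) (boundVars m) ++ var 0 ∷ []
boundVars-snoc zero    = refl
boundVars-snoc (suc m) = cong (var (suc m) ∷_) (boundVars-snoc m)

lams-snoc : ∀ m A → lams (suc m) A ≡ lams m (lam A)
lams-snoc zero    A = refl
lams-snoc (suc m) A = cong lam (lams-snoc m A)

-- λz₁…zₘ. x z₁ ⋯ zₘ ↠η x, contracting the innermost η-redex first.
η-expansion-↠βη : ∀ m x → lams m (apps (m + x) (boundVars m)) ↠βη var x
η-expansion-↠βη zero    x = ε
η-expansion-↠βη (suc m) x =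
  transport (_↠βη var x) (sym (trans (lams-snoc m _) (cong (λ X → lams m (lam X)) innermost)))
    (↠βη-lams m (η ◅ ε) ◅◅ η-expansion-↠βη m x)
  where
  innermost : apps (suc m + x) (boundVars (suc m)) ≡ app (rename suc (apps (m + x) (boundVars m))) (var 0)
  innermost = begin
    apps (suc m + x) (boundVars (suc m))
      ≡⟨ cong (apps (suc (m + x))) (boundVars-snoc m) ⟩
    foldl app (var (suc (m + x))) (map (rename suc) (boundVars m) ++ var 0 ∷ [])
      ≡⟨ apps-snoc (var (suc (m + x))) (map (rename suc) (boundVars m)) (var 0) ⟩
    app (foldl app (var (suc (m + x))) (map (rename suc) (boundVars m))) (var 0)
      ≡⟨ cong (λ X → app X (var 0)) (sym (rename-apps suc (var (m + x)) (boundVars m))) ⟩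
    app (rename suc (apps (m + x) (boundVars m))) (var 0) ∎
    where open ≡-Reasoning

etaTree⇒↠βη : ∀ {s x T M} → EtaTree s x T → IsBT M T → M ↠βη var x
etaTree⇒↠βη {x = x} (eta-node m root _ children) bt with BT-root bt root
... | Ms , red , refl , argsBT =
  ↠β⇒↠βη red
    ◅◅ ↠βη-lams m (↠βη-apps Ms (boundVars m) (sym (boundVars-length m)) args ε)
    ◅◅ η-expansion-↠βη m x
  where
  args : ∀ j → j < length Ms → at Ms j ↠βη at (boundVars (length Ms)) j
  args j lt with children j lt
  ... | _ , _ , E = transport (at Ms j ↠βη_) (sym (boundVars-at m j lt)) (etaTree⇒↠βη E (argsBT j lt))

size-intro : ∀ {L} m Qs s → length Qs ≡ m → L ↠β lams (suc m) (apps m Qs) → m ≤ s →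
  (∀ j → j < m → Σ ℕ λ t → t < s × Size (lam (rename (pull (m ∸ suc j)) (at Qs j))) t) →
  Σ ℕ λ s' → s' ≤ s × Size L s'
size-intro _ []       s       refl r _   _ = 0 , z≤n , size-id r
size-intro _ (Q ∷ Qs) (suc s) refl r m≤s args =
  _ , ⊔-lub m≤s (s≤s (maxF-least _ sz s (λ j → s≤s⁻¹ (size< j)))) , size-hnf (Q ∷ Qs) sz (s≤s z≤n) r kids
  where
  sz : Fin (length (Q ∷ Qs)) → ℕ
  sz j = proj₁ (args (toℕ j) (toℕ<n j))
  size< : ∀ j → sz j < suc s
  size< j = proj₁ (proj₂ (args (toℕ j) (toℕ<n j)))
  kids : ∀ j → Size (lamZ (Q ∷ Qs) j) (sz j)
  kids j = transport (λ X → Size X (sz j)) (sym (lamZ-at (Q ∷ Qs) j)) (proj₂ (proj₂ (args (toℕ j) (toℕ<n j))))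

-- A term M whose Böhm tree is an η-expansion tree of x of size s gives,
-- once x is abstracted (ρ sends x to the new variable 0), a term of size ≤ s.
etaTree⇒size : ∀ {s x T M} → EtaTree s x T → IsBT M T → ∀ ρ → ρ x ≡ 0 →
  Σ ℕ λ s' → s' ≤ s × Size (lam (rename ρ M)) s'
etaTree⇒size {s} {x} {M = M} (eta-node m root m≤s children) bt ρ ρx with BT-root bt root
... | Ms , red , refl , argsBT = size-intro m Qs s (length-map f Ms) reduction m≤s argSize
  where
  f = rename (extN m ρ)
  Qs = map f Ms
  head≡m : extN m ρ (m + x) ≡ m
  head≡m = trans (extN-high m ρ x) (trans (cong (m +_) ρx) (+-identityʳ m))
  reduction : lam (rename ρ M) ↠β lams (suc m) (apps m Qs)
  reduction = ↠β-lam (transport (rename ρ M ↠β_)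
                (trans (rename-hnf ρ m (m + x) Ms) (cong (λ h → lams m (apps h Qs)) head≡m))
                (rename-↠β ρ red))
  argSize : ∀ j → j < m → Σ ℕ λ t → t < s × Size (lam (rename (pull (m ∸ suc j)) (at Qs j))) t
  argSize j lt with children j lt
  ... | t , t<s , E
    with etaTree⇒size E (argsBT j lt) (pull (m ∸ suc j) ∘ extN m ρ)
           (trans (cong (pull (m ∸ suc j)) (extN-low m ρ _ (mirror< lt))) (pull-self _))
  ... | t' , t'≤t , S =
    t' , ≤-<-trans t'≤t t<s ,
    transport (λ X → Size (lam X) t')
      (trans (sym (rename-rename (pull (m ∸ suc j)) (extN m ρ) (at Ms j)))
             (cong (rename (pull (m ∸ suc j))) (sym (at-map f Ms j lt)))) S

etaTree⇒ETAp : ∀ {p s Q T} → EtaTree s 0 T → IsBT Q T → s < p → ETAp p (lam Q)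
etaTree⇒ETAp {Q = Q} E bt s<p with etaTree⇒size E bt id refl
... | s' , s'≤s , size =
  ↠βη-lam (etaTree⇒↠βη E bt) ,
  s' , transport (λ X → Size (lam X) s') (rename-id (λ _ → refl) Q) size , ≤-<-trans s'≤s s<p

lemma7p7 : (p p' : ℕ) (Q Q' : Term) (T T' : Tree) →
           IsBT Q T → IsBT Q' T' →
           ETAp p (lam Q) → T ≤η[ p' ] T' →
           ETAp (p + p') (lam Q')
lemma7p7 p p' Q Q' T T' btQ btQ' (_ , s , sizeλQ , s<p) (R , rTT' , post) =
  etaTree⇒ETAp (etaTree-≤η post (etaTree-of-lam sizeλQ ε btQ) rTT') btQ' (+-monoˡ-< p' s<p)
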